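{- Let $\Gamma$ be a countable graph. Then there exist $2^{\aleph_0}$ pairwise non-isomorphic countable algebraically closed graphs whose automorphism group is isomorphic to $\operatorname{Aut}\Gamma$.
   Context: A graph is a pair $(V,E)$ with $V$ a non-empty set and $E$ an irreflexive symmetric binary relation on $V$ (undirected, no loops or multiple edges). A graph is algebraically closed if for every finite set $A$ of vertices there is a vertex adjacent to every vertex of $A$. -}

module Defs where

open import Data.Nat using (ℕ)
open import Data.Bool using (Bool)
open import Data.List using (List)
open import Data.List.Relation.Unary.All using (All)
open import Data.Product using (Σ; _×_)
open import Data.Empty using (⊥)
open import Relation.Binary.PropositionalEquality using (_≡_)
open import Relation.Nullary using (¬_)

-- A graph: non-empty vertex set V with an irreflexive symmetric adjacency relation.
-- A *countable* graph additionally has a surjection ℕ → V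
-- (this encodes "V is countable and non-empty").
record CountableGraph : Set₁ where
  field
    V     : Set
    E     : V → V → Set
    irrefl : ∀ x → ¬ E x x
    sym   : ∀ {x y} → E x y → E y x
    enum  : ℕ → V
    enum-surj : ∀ (v : V) → Σ ℕ (λ n → enum n ≡ v)
open CountableGraph public

AlgClosed : CountableGraph → Set
AlgClosed G = ∀ (A : List (V G)) → Σ (V G) (λ v → All (λ a → E G v a) A)

record GraphIso (G H : CountableGraph) : Set where
  field
    to   : V G → V H
    from : V H → V G
    to-from : ∀ y → to (from y) ≡ y
    from-to : ∀ x → from (to x) ≡ x
    pres : ∀ {x y} → E G x y → E H (to x) (to y)
    refl : ∀ {x y} → E H (to x) (to y) → E G x y

Aut : CountableGraph → Set
Aut G = GraphIso G G

_∘A_ : ∀ {G} → Aut G → Aut G → Aut G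
_∘A_ {G} f g = record
  { to = λ x → F.to (Gg.to x)
  ; from = λ x → Gg.from (F.from x)
  ; to-from = λ y → trans (cong F.to (Gg.to-from (F.from y))) (F.to-from y)
  ; from-to = λ x → trans (cong Gg.from (F.from-to (Gg.to x))) (Gg.from-to x)
  ; pres = λ e → F.pres (Gg.pres e)
  ; refl = λ e → Gg.refl (F.refl e)
  }
  where
  module F = GraphIso f
  module Gg = GraphIso g
  open import Relation.Binary.PropositionalEquality using (trans; cong)

_≈A_ : ∀ {G} → Aut G → Aut G → Set
f ≈A g = ∀ x → GraphIso.to f x ≡ GraphIso.to g x

record AutGroupIso (G H : CountableGraph) : Set where
  field
    φ     : Aut G → Aut H
    φ-cong : ∀ {f g} → f ≈A g → φ f ≈A φ g
    φ-hom  : ∀ f g → φ (f ∘A g) ≈A (φ f ∘A φ g)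
    φ-inj  : ∀ {f g} → φ f ≈A φ g → f ≈A g
    φ-surj : ∀ h → Σ (Aut G) (λ f → φ f ≈A h)

-- Glue a fixed gadget to Γ: every vertex of Γ is joined to every gadget vertex except
-- those of a 5-clique. In the complement, the gadget is that 5-clique with a ray
-- ray 0, ray 1, … hanging off it (ray i tied to clique vertex i) and a pendant at ray n
-- exactly when s n holds. Counting non-neighbours separates the vertex types
-- (≥ 5 for Γ and the clique, 2–4 on the ray, ≤ 1 for pendants), the ray is a rigid
-- path, and everything else is pinned to the ray; so an isomorphism between two such
-- graphs fixes the gadget, which recovers s, and automorphisms are exactly those of Γ
-- extended by the identity. Far-out ray vertices are adjacent to any given finite set.
module Submission where

open import Defs
open import Data.Bool using (Bool; true; false; T)
open import Data.Bool.Properties using (T-irrelevant)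
open import Data.Empty using (⊥; ⊥-elim)
open import Data.Fin using (Fin; zero; suc; toℕ; punchIn; inject≤)
open import Data.Fin.Properties
  using (toℕ-injective; toℕ-fromℕ<; toℕ<n; punchIn-injective; punchInᵢ≢i; pigeonhole; inject≤-injective)
  renaming (<⇒≢ to <⇒≢ᶠ)
open import Data.List using ([]; _∷_; map)
open import Data.List.Relation.Unary.All using (All; []; _∷_)
import Data.List.Relation.Unary.All as All
open import Data.Nat using (ℕ; zero; suc; pred; _+_; _≤_; _<_; z≤n; s≤s; NonZero; _≟_)
open import Data.Nat.DivMod using (_mod_; m<n⇒m%n≡m)
open import Data.Nat.ListAction using (sum)
open import Data.Nat.Properties
  using (suc-injective; 1+n≢n; m≢1+n+m; <⇒≢; <-asym; ≤-trans; ≤-reflexive; m≤m+n; m≤n+m; n≤1+n)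
open import Data.Product using (Σ; ∃; _×_; _,_; proj₁; proj₂)
open import Data.Sum using (_⊎_; inj₁; inj₂; swap; map₁)
open import Data.Sum.Properties using (inj₁-injective)
open import Data.Unit using (⊤; tt)
open import Function using (_∘_; id)
open import Function.Definitions using (Injective)
open import Relation.Binary.PropositionalEquality
  using (_≡_; _≢_; refl; trans; cong; subst; subst₂; module ≡-Reasoning)
  renaming (sym to ≡-sym)
open import Relation.Nullary using (¬_; Dec; yes; no)
open import Relation.Nullary.Decidable using (decidable-stable; _⊎-dec_; T?)

-- Non-neighbours and isomorphisms

GraphIso-sym : ∀ {G H} → GraphIso G H → GraphIso H G
GraphIso-sym {G} {H} f = record
  { to = from ; from = to ; to-from = from-to ; from-to = to-from
  ; pres = λ {x} {y} e → GraphIso.refl f (subst₂ (E H) (≡-sym (to-from x)) (≡-sym (to-from y)) e)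
  ; refl = λ {x} {y} e → subst₂ (E H) (to-from x) (to-from y) (pres e)
  }
  where open GraphIso f

to-injective : ∀ {G H} (f : GraphIso G H) → Injective _≡_ _≡_ (GraphIso.to f)
to-injective f {x} {y} e = begin
  x              ≡⟨ ≡-sym (from-to x) ⟩
  from (to x)    ≡⟨ cong from e ⟩
  from (to y)    ≡⟨ from-to y ⟩
  y              ∎
  where open GraphIso f
        open ≡-Reasoning

NonNeighbour : (G : CountableGraph) → V G → V G → Set
NonNeighbour G x y = y ≢ x × ¬ E G x y

HasNonNeighbours : ℕ → (G : CountableGraph) → V G → Set
HasNonNeighbours k G x =
  Σ (Fin k → V G) λ g → Injective _≡_ _≡_ g × (∀ i → NonNeighbour G x (g i))

AtMostNonNeighbours : ℕ → (G : CountableGraph) → V G → Set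
AtMostNonNeighbours m G x =
  Σ (Fin m → V G) λ c → ∀ {y} → NonNeighbour G x y → ∃ λ i → c i ≡ y

module NonNeighbourCounting (G : CountableGraph) {x : V G} where

  atMost⇒¬has : ∀ {m k} → m < k → AtMostNonNeighbours m G x → ¬ HasNonNeighbours k G x
  atMost⇒¬has m<k (c , covers) (g , g-inj , nn) with pigeonhole m<k (proj₁ ∘ covers ∘ nn)
  ... | i , j , i<j , same = <⇒≢ᶠ i<j (g-inj (begin
    g i                      ≡⟨ ≡-sym (proj₂ (covers (nn i))) ⟩
    c (proj₁ (covers (nn i))) ≡⟨ cong c same ⟩
    c (proj₁ (covers (nn j))) ≡⟨ proj₂ (covers (nn j)) ⟩
    g j                      ∎))
    where open ≡-Reasoning

  HasNonNeighbours-≤ : ∀ {j k} → j ≤ k → HasNonNeighbours k G x → HasNonNeighbours j G x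
  HasNonNeighbours-≤ j≤k (g , g-inj , nn) =
    g ∘ inject≤′ , inject≤-injective j≤k j≤k _ _ ∘ g-inj , nn ∘ inject≤′
    where inject≤′ = λ i → inject≤ i j≤k

  two-nonNeighbours : ∀ {y y′} → y ≢ y′ → NonNeighbour G x y → NonNeighbour G x y′ →
                      HasNonNeighbours 2 G x
  two-nonNeighbours {y} {y′} y≢y′ nn nn′ = g , g-inj , λ { zero → nn ; (suc _) → nn′ }
    where
    g : Fin 2 → V G
    g zero = y
    g (suc _) = y′
    g-inj : Injective _≡_ _≡_ g
    g-inj {zero}        {zero}        _ = refl
    g-inj {zero}        {suc _}       e = ⊥-elim (y≢y′ e)
    g-inj {suc _}       {zero}        e = ⊥-elim (y≢y′ (≡-sym e))
    g-inj {suc zero}    {suc zero}    _ = refl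

module _ {G H : CountableGraph} (f : GraphIso G H) where
  open GraphIso f using (to)

  NonNeighbour-to : ∀ {x y} → NonNeighbour G x y → NonNeighbour H (to x) (to y)
  NonNeighbour-to (y≢x , ¬xy) = y≢x ∘ to-injective f , ¬xy ∘ GraphIso.refl f

  HasNonNeighbours-to : ∀ {k x} → HasNonNeighbours k G x → HasNonNeighbours k H (to x)
  HasNonNeighbours-to (g , g-inj , nn) = to ∘ g , g-inj ∘ to-injective f , NonNeighbour-to ∘ nn

module _ {G H : CountableGraph} (f : GraphIso G H) where
  open GraphIso f using (to; from-to)

  HasNonNeighbours-from : ∀ {k x} → HasNonNeighbours k H (to x) → HasNonNeighbours k G x
  HasNonNeighbours-from {k} {x} h =
    subst (HasNonNeighbours k G) (from-to x) (HasNonNeighbours-to (GraphIso-sym f) h)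

RayLike : (G : CountableGraph) → V G → Set
RayLike G x = HasNonNeighbours 2 G x × ¬ HasNonNeighbours 5 G x

RayLike-to : ∀ {G H} (f : GraphIso G H) {x} → RayLike G x → RayLike H (GraphIso.to f x)
RayLike-to f (two , ¬five) = HasNonNeighbours-to f two , ¬five ∘ HasNonNeighbours-from f

-- The one-way infinite path

Consecutive : ℕ → ℕ → Set
Consecutive m n = n ≡ suc m ⊎ m ≡ suc n

Consecutive⇒≢ : ∀ {m n} → Consecutive m n → m ≢ n
Consecutive⇒≢ (inj₁ n≡1+m) m≡n = 1+n≢n (trans (≡-sym n≡1+m) (≡-sym m≡n))
Consecutive⇒≢ (inj₂ m≡1+n) m≡n = 1+n≢n (trans (≡-sym m≡1+n) m≡n)

Consecutive-zero : ∀ {n} → Consecutive 0 n → n ≡ 1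
Consecutive-zero (inj₁ n≡1) = n≡1

module _ (σ τ : ℕ → ℕ) (τσ : ∀ n → τ (σ n) ≡ n) (στ : ∀ n → σ (τ n) ≡ n)
         (σ-consecutive : ∀ {m n} → Consecutive m n → Consecutive (σ m) (σ n))
         (τ-consecutive : ∀ {m n} → Consecutive m n → Consecutive (τ m) (τ n)) where
  open ≡-Reasoning

  private
    σ-injective : ∀ {m n} → σ m ≡ σ n → m ≡ n
    σ-injective {m} {n} e = trans (≡-sym (τσ m)) (trans (cong τ e) (τσ n))

    -- If σ 0 were k + 1, both neighbours k and k + 2 of k + 1 would be sent by τ to
    -- the only neighbour 1 of 0.
    σ-zero : σ 0 ≡ 0
    σ-zero with σ 0 in σ0≡
    ... | zero = refl
    ... | suc k = ⊥-elim (m≢1+n+m k {1} (begin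
      k                  ≡⟨ ≡-sym (στ k) ⟩
      σ (τ k)            ≡⟨ cong σ (τ-to-one (inj₂ refl)) ⟩
      σ 1                ≡⟨ cong σ (≡-sym (τ-to-one (inj₁ refl))) ⟩
      σ (τ (suc (suc k))) ≡⟨ στ (suc (suc k)) ⟩
      suc (suc k)        ∎))
      where
      τ-to-one : ∀ {n} → Consecutive (suc k) n → τ n ≡ 1
      τ-to-one {n} c = Consecutive-zero
        (subst (λ z → Consecutive z (τ n)) (trans (cong τ (≡-sym σ0≡)) (τσ 0)) (τ-consecutive c))

    σ-one : σ 0 ≡ 0 → σ 1 ≡ 1
    σ-one σ0 = Consecutive-zero (subst (λ z → Consecutive z (σ 1)) σ0 (σ-consecutive (inj₁ refl)))

    σ-step : ∀ {m} → σ m ≡ m → σ (suc m) ≡ suc m → σ (suc (suc m)) ≡ suc (suc m)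
    σ-step {m} σm σm+1 with subst (λ z → Consecutive z (σ (suc (suc m)))) σm+1 (σ-consecutive (inj₁ refl))
    ... | inj₁ e = e
    ... | inj₂ e = ⊥-elim (m≢1+n+m m {1} (σ-injective (trans σm (suc-injective e))))

  path-automorphism≗id : ∀ n → σ n ≡ n
  path-automorphism≗id zero = σ-zero
  path-automorphism≗id (suc zero) = σ-one σ-zero
  path-automorphism≗id (suc (suc n)) =
    σ-step (path-automorphism≗id n) (path-automorphism≗id (suc n))

-- Enumerations

Enumeration : Set → Set
Enumeration A = Σ (ℕ → A) λ e → ∀ a → ∃ λ n → e n ≡ a

interleave : ∀ {A : Set} → (ℕ → A) → (ℕ → A) → ℕ → A
interleave f g zero = f zero
interleave f g (suc n) = interleave g (f ∘ suc) n

interleave-left : ∀ {A : Set} (f g : ℕ → A) k → ∃ λ n → interleave f g n ≡ f k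
interleave-right : ∀ {A : Set} (f g : ℕ → A) k → ∃ λ n → interleave f g n ≡ g k
interleave-left f g zero = zero , refl
interleave-left f g (suc k) with interleave-right g (f ∘ suc) k
... | n , e = suc n , e
interleave-right f g k with interleave-left g (f ∘ suc) k
... | n , e = suc n , e

⊎-enumeration : ∀ {A B : Set} → Enumeration A → Enumeration B → Enumeration (A ⊎ B)
⊎-enumeration (a , a-onto) (b , b-onto) = interleave (inj₁ ∘ a) (inj₂ ∘ b) , onto
  where
  onto : ∀ x → ∃ λ n → interleave (inj₁ ∘ a) (inj₂ ∘ b) n ≡ x
  onto (inj₁ x) with a-onto x
  ... | k , refl = interleave-left (inj₁ ∘ a) (inj₂ ∘ b) k
  onto (inj₂ y) with b-onto y
  ... | k , refl = interleave-right (inj₁ ∘ a) (inj₂ ∘ b) k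

map-enumeration : ∀ {A B : Set} (f : A → B) → (∀ b → ∃ λ a → f a ≡ b) →
                  Enumeration A → Enumeration B
map-enumeration f f-onto (e , e-onto) = f ∘ e , onto
  where
  onto : ∀ b → ∃ λ n → f (e n) ≡ b
  onto b with f-onto b
  ... | a , refl with e-onto a
  ... | n , refl = n , refl

ℕ-enumeration : Enumeration ℕ
ℕ-enumeration = id , λ n → n , refl

toℕ-mod : ∀ {n} .{{_ : NonZero n}} (i : Fin n) → toℕ i mod n ≡ i
toℕ-mod i = toℕ-injective (trans (toℕ-fromℕ< _) (m<n⇒m%n≡m (toℕ<n i)))

Fin-enumeration : ∀ n .{{_ : NonZero n}} → Enumeration (Fin n)
Fin-enumeration n = (_mod n) , λ i → toℕ i , toℕ-mod i

-- The construction

data Gadget (s : ℕ → Bool) : Set where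
  clique  : Fin 5 → Gadget s
  ray     : ℕ → Gadget s
  pendant : (n : ℕ) → T (s n) → Gadget s

pattern core u = inj₁ u
pattern gadget x = inj₂ x

module Construction (Γ : CountableGraph) (s : ℕ → Bool) where

  -- Non-adjacency inside the gadget, made reflexive so that Adj below is irreflexive.
  Linked : Gadget s → Gadget s → Set
  Linked (clique _)    (clique _)    = ⊤
  Linked (clique i)    (ray n)       = toℕ i ≡ n
  Linked (ray n)       (clique i)    = toℕ i ≡ n
  Linked (ray m)       (ray n)       = m ≡ n ⊎ Consecutive m n
  Linked (ray m)       (pendant n _) = m ≡ n
  Linked (pendant m _) (ray n)       = m ≡ n
  Linked (pendant m _) (pendant n _) = m ≡ n
  Linked _             _             = ⊥

  Linked-refl : ∀ x → Linked x x
  Linked-refl (clique _) = tt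
  Linked-refl (ray _) = inj₁ refl
  Linked-refl (pendant _ _) = refl

  Linked-sym : ∀ x y → Linked x y → Linked y x
  Linked-sym (clique _)    (clique _)    _        = tt
  Linked-sym (clique _)    (ray _)       e        = e
  Linked-sym (ray _)       (clique _)    e        = e
  Linked-sym (ray _)       (ray _)       (inj₁ e) = inj₁ (≡-sym e)
  Linked-sym (ray _)       (ray _)       (inj₂ c) = inj₂ (swap c)
  Linked-sym (ray _)       (pendant _ _) e        = ≡-sym e
  Linked-sym (pendant _ _) (ray _)       e        = ≡-sym e
  Linked-sym (pendant _ _) (pendant _ _) e        = ≡-sym e

  linked? : ∀ x y → Dec (Linked x y)
  linked? (clique _)    (clique _)    = yes tt
  linked? (clique i)    (ray n)       = toℕ i ≟ n
  linked? (clique _)    (pendant _ _) = no λ ()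
  linked? (ray n)       (clique i)    = toℕ i ≟ n
  linked? (ray m)       (ray n)       = (m ≟ n) ⊎-dec ((n ≟ suc m) ⊎-dec (m ≟ suc n))
  linked? (ray m)       (pendant n _) = m ≟ n
  linked? (pendant _ _) (clique _)    = no λ ()
  linked? (pendant m _) (ray n)       = m ≟ n
  linked? (pendant m _) (pendant n _) = m ≟ n

  CoreAdj : Gadget s → Set
  CoreAdj (clique _) = ⊥
  CoreAdj _          = ⊤

  Vertex : Set
  Vertex = V Γ ⊎ Gadget s

  Adj : Vertex → Vertex → Set
  Adj (core u)   (core v)   = E Γ u v
  Adj (core _)   (gadget y) = CoreAdj y
  Adj (gadget x) (core _)   = CoreAdj x
  Adj (gadget x) (gadget y) = ¬ Linked x y

  core-injective : ∀ {u v} → _≡_ {A = Vertex} (core u) (core v) → u ≡ v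
  core-injective = inj₁-injective

  clique-injective : ∀ {i j} → _≡_ {A = Vertex} (gadget (clique i)) (gadget (clique j)) → i ≡ j
  clique-injective refl = refl

  ray-injective : ∀ {m n} → _≡_ {A = Vertex} (gadget (ray m)) (gadget (ray n)) → m ≡ n
  ray-injective refl = refl

  Adj-irrefl : ∀ x → ¬ Adj x x
  Adj-irrefl (core u) = irrefl Γ u
  Adj-irrefl (gadget x) adj = adj (Linked-refl x)

  Adj-sym : ∀ {x y} → Adj x y → Adj y x
  Adj-sym {core _}   {core _}   adj = sym Γ adj
  Adj-sym {core _}   {gadget _} adj = adj
  Adj-sym {gadget _} {core _}   adj = adj
  Adj-sym {gadget x} {gadget y} adj = adj ∘ Linked-sym y x

  pendant-or-ray : ℕ → Gadget s
  pendant-or-ray n with T? (s n)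
  ... | yes p = pendant n p
  ... | no _ = ray n

  pendant-or-ray-pendant : ∀ n p → pendant-or-ray n ≡ pendant n p
  pendant-or-ray-pendant n p with T? (s n)
  ... | yes q = cong (pendant n) (T-irrelevant q p)
  ... | no ¬p = ⊥-elim (¬p p)

  Gadget-enumeration : Enumeration (Gadget s)
  Gadget-enumeration = map-enumeration decode onto
    (⊎-enumeration (Fin-enumeration 5) (⊎-enumeration ℕ-enumeration ℕ-enumeration))
    where
    decode : Fin 5 ⊎ (ℕ ⊎ ℕ) → Gadget s
    decode (inj₁ i) = clique i
    decode (inj₂ (inj₁ n)) = ray n
    decode (inj₂ (inj₂ n)) = pendant-or-ray n
    onto : ∀ x → ∃ λ a → decode a ≡ x
    onto (clique i) = inj₁ i , refl
    onto (ray n) = inj₂ (inj₁ n) , refl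
    onto (pendant n p) = inj₂ (inj₂ n) , pendant-or-ray-pendant n p

  Vertex-enumeration : Enumeration Vertex
  Vertex-enumeration = ⊎-enumeration (enum Γ , enum-surj Γ) Gadget-enumeration

  graph : CountableGraph
  graph = record
    { V = Vertex ; E = Adj ; irrefl = Adj-irrefl ; sym = λ {x} {y} → Adj-sym {x} {y}
    ; enum = proj₁ Vertex-enumeration ; enum-surj = proj₂ Vertex-enumeration }

  open NonNeighbourCounting graph

  nonNeighbour⇒Linked : ∀ {x y} → NonNeighbour graph (gadget x) (gadget y) → Linked x y
  nonNeighbour⇒Linked {x} {y} (_ , ¬adj) = decidable-stable (linked? x y) ¬adj

  consecutive⇒nonNeighbour : ∀ {m n} → Consecutive m n →
                             NonNeighbour graph (gadget (ray m)) (gadget (ray n))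
  consecutive⇒nonNeighbour c = (λ { refl → Consecutive⇒≢ c refl }) , λ adj → adj (inj₂ c)

  nonNeighbour⇒consecutive : ∀ {m n} → NonNeighbour graph (gadget (ray m)) (gadget (ray n)) →
                             Consecutive m n
  nonNeighbour⇒consecutive nn with nonNeighbour⇒Linked nn
  ... | inj₁ refl = ⊥-elim (proj₁ nn refl)
  ... | inj₂ c = c

  data RayNonNeighbour (n : ℕ) : Vertex → Set where
    clique  : ∀ {i} → toℕ i ≡ n → RayNonNeighbour n (gadget (clique i))
    pendant : ∀ {m p} → n ≡ m → RayNonNeighbour n (gadget (pendant m p))
    ray     : ∀ {m} → Consecutive n m → RayNonNeighbour n (gadget (ray m))

  classify-ray : ∀ {n y} → NonNeighbour graph (gadget (ray n)) y → RayNonNeighbour n y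
  classify-ray {y = core _} (_ , ¬adj) = ⊥-elim (¬adj tt)
  classify-ray {y = gadget (clique _)} nn = clique (nonNeighbour⇒Linked nn)
  classify-ray {y = gadget (ray _)} nn = ray (nonNeighbour⇒consecutive nn)
  classify-ray {y = gadget (pendant _ _)} nn = pendant (nonNeighbour⇒Linked nn)

  core-has5 : ∀ u → HasNonNeighbours 5 graph (core u)
  core-has5 u = (λ i → gadget (clique i)) , (λ { refl → refl }) , λ _ → (λ ()) , λ ()

  clique-has5 : ∀ i → HasNonNeighbours 5 graph (gadget (clique i))
  clique-has5 i = g , g-inj , nn
    where
    g : Fin 5 → Vertex
    g zero = gadget (ray (toℕ i))
    g (suc j) = gadget (clique (punchIn i j))
    g-inj : Injective _≡_ _≡_ g
    g-inj {zero} {zero} _ = refl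
    g-inj {suc j} {suc k} e = cong suc (punchIn-injective i j k (clique-injective e))
    nn : ∀ j → NonNeighbour graph (gadget (clique i)) (g j)
    nn zero = (λ ()) , λ adj → adj refl
    nn (suc j) = punchInᵢ≢i i j ∘ clique-injective , λ adj → adj tt

  ray-has2 : ∀ n → HasNonNeighbours 2 graph (gadget (ray n))
  ray-has2 zero =
    two-nonNeighbours {y = gadget (ray 1)} {y′ = gadget (clique zero)} (λ ())
      (consecutive⇒nonNeighbour (inj₁ refl)) ((λ ()) , λ adj → adj refl)
  ray-has2 (suc n) =
    two-nonNeighbours (m≢1+n+m n {1} ∘ ray-injective)
      (consecutive⇒nonNeighbour (inj₂ refl)) (consecutive⇒nonNeighbour (inj₁ refl))

  -- The candidates are ray (n ± 1), the pendant at n and clique vertex n; when the last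
  -- two do not exist, pendant-or-ray and n mod 5 supply harmless stand-ins.
  ray-atMost4 : ∀ n → AtMostNonNeighbours 4 graph (gadget (ray n))
  ray-atMost4 n = c , covers ∘ classify-ray
    where
    c : Fin 4 → Vertex
    c zero = gadget (clique (n mod 5))
    c (suc zero) = gadget (pendant-or-ray n)
    c (suc (suc zero)) = gadget (ray (suc n))
    c (suc (suc (suc _))) = gadget (ray (pred n))
    covers : ∀ {y} → RayNonNeighbour n y → ∃ λ i → c i ≡ y
    covers (clique {i} refl) = zero , cong (λ z → gadget (clique z)) (toℕ-mod i)
    covers (pendant {p = p} refl) = suc zero , cong gadget (pendant-or-ray-pendant n p)
    covers (ray (inj₁ refl)) = suc (suc zero) , refl
    covers (ray (inj₂ refl)) = suc (suc (suc zero)) , refl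

  pendant-atMost1 : ∀ n p → AtMostNonNeighbours 1 graph (gadget (pendant n p))
  pendant-atMost1 n p = (λ _ → gadget (ray n)) , λ nn → zero , ≡-sym (is-ray _ nn)
    where
    is-ray : ∀ y → NonNeighbour graph (gadget (pendant n p)) y → y ≡ gadget (ray n)
    is-ray (core _) (_ , ¬adj) = ⊥-elim (¬adj tt)
    is-ray (gadget (clique _)) (_ , ¬adj) = ⊥-elim (¬adj λ ())
    is-ray (gadget (ray m)) nn = cong (λ z → gadget (ray z)) (≡-sym (nonNeighbour⇒Linked nn))
    is-ray (gadget (pendant m q)) nn with nonNeighbour⇒Linked nn
    ... | refl = ⊥-elim (proj₁ nn (cong (λ z → gadget (pendant n z)) (T-irrelevant q p)))

  ray-few : ∀ {n} → ¬ HasNonNeighbours 5 graph (gadget (ray n))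
  ray-few = atMost⇒¬has (s≤s (s≤s (s≤s (s≤s (s≤s z≤n))))) (ray-atMost4 _)

  pendant-few : ∀ {n p} → ¬ HasNonNeighbours 2 graph (gadget (pendant n p))
  pendant-few = atMost⇒¬has (s≤s (s≤s z≤n)) (pendant-atMost1 _ _)

  has5⇒has2 : ∀ {y} → HasNonNeighbours 5 graph y → HasNonNeighbours 2 graph y
  has5⇒has2 = HasNonNeighbours-≤ (s≤s (s≤s z≤n))

  RayLike⇒ray : ∀ {y} → RayLike graph y → ∃ λ n → y ≡ gadget (ray n)
  RayLike⇒ray {core u} (_ , ¬five) = ⊥-elim (¬five (core-has5 u))
  RayLike⇒ray {gadget (clique i)} (_ , ¬five) = ⊥-elim (¬five (clique-has5 i))
  RayLike⇒ray {gadget (ray n)} _ = n , refl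
  RayLike⇒ray {gadget (pendant _ _)} (two , _) = ⊥-elim (pendant-few two)

  RayLike-ray : ∀ n → RayLike graph (gadget (ray n))
  RayLike-ray n = ray-has2 n , ray-few

  clique-at-ray : ∀ {i y} → HasNonNeighbours 5 graph y →
                  NonNeighbour graph (gadget (ray (toℕ i))) y → y ≡ gadget (clique i)
  clique-at-ray five nn with classify-ray nn
  ... | clique e = cong (λ z → gadget (clique z)) (toℕ-injective e)
  ... | pendant _ = ⊥-elim (pendant-few (has5⇒has2 five))
  ... | ray _ = ⊥-elim (ray-few five)

  pendant-at-ray : ∀ {n y} → ¬ HasNonNeighbours 2 graph y →
                   NonNeighbour graph (gadget (ray n)) y → Σ (T (s n)) λ p → y ≡ gadget (pendant n p)
  pendant-at-ray ¬two nn with classify-ray nn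
  ... | clique {i} _ = ⊥-elim (¬two (has5⇒has2 (clique-has5 i)))
  ... | pendant {p = p} refl = p , refl
  ... | ray {m} _ = ⊥-elim (¬two (ray-has2 m))

  -- A clique vertex is not adjacent to the ray vertex tied to it.
  core-by-rays : ∀ {y} → HasNonNeighbours 5 graph y → (∀ n → Adj (gadget (ray n)) y) →
                 ∃ λ u → y ≡ core u
  core-by-rays {core u} _ _ = u , refl
  core-by-rays {gadget (clique i)} _ adj = ⊥-elim (adj (toℕ i) refl)
  core-by-rays {gadget (ray _)} five _ = ⊥-elim (ray-few five)
  core-by-rays {gadget (pendant _ _)} five _ = ⊥-elim (pendant-few (has5⇒has2 five))

  Adj-map₁ : (g : V Γ → V Γ) → (∀ {u v} → E Γ u v → E Γ (g u) (g v)) →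
             ∀ {x y} → Adj x y → Adj (map₁ g x) (map₁ g y)
  Adj-map₁ g g-pres {core _}   {core _}   adj = g-pres adj
  Adj-map₁ g g-pres {core _}   {gadget _} adj = adj
  Adj-map₁ g g-pres {gadget _} {core _}   adj = adj
  Adj-map₁ g g-pres {gadget _} {gadget _} adj = adj

  height : Vertex → ℕ
  height (core _) = 0
  height (gadget (clique i)) = toℕ i
  height (gadget (ray n)) = n
  height (gadget (pendant n _)) = n

  far-ray-adjacent : ∀ {N y} → 2 + height y ≤ N → Adj (gadget (ray N)) y
  far-ray-adjacent {y = core _} _ = tt
  far-ray-adjacent {y = gadget (clique _)} le e = <⇒≢ (≤-trans (n≤1+n _) le) e
  far-ray-adjacent {y = gadget (ray _)} le (inj₁ e) = <⇒≢ (≤-trans (n≤1+n _) le) (≡-sym e)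
  far-ray-adjacent {y = gadget (ray _)} le (inj₂ (inj₁ e)) =
    <-asym (≤-trans (n≤1+n _) le) (≤-reflexive (≡-sym e))
  far-ray-adjacent {y = gadget (ray _)} le (inj₂ (inj₂ e)) = <⇒≢ le (≡-sym e)
  far-ray-adjacent {y = gadget (pendant _ _)} le e = <⇒≢ (≤-trans (n≤1+n _) le) (≡-sym e)

All-≤-sum : ∀ {A : Set} (h : A → ℕ) xs → All (λ x → h x ≤ sum (map h xs)) xs
All-≤-sum h [] = []
All-≤-sum h (x ∷ xs) =
  m≤m+n (h x) _ ∷ All.map (λ le → ≤-trans le (m≤n+m _ (h x))) (All-≤-sum h xs)

open Construction using (graph)

algebraicallyClosed : ∀ Γ s → AlgClosed (graph Γ s)
algebraicallyClosed Γ s A =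
  gadget (ray (2 + sum (map height A))) ,
  All.map (λ {y} le → far-ray-adjacent {y = y} (s≤s (s≤s le))) (All-≤-sum height A)
  where open Construction Γ s

-- Rigidity

module RayIndex (Γ : CountableGraph) {s t : ℕ → Bool} (f : GraphIso (graph Γ s) (graph Γ t)) where
  open GraphIso f using (to)
  private
    module Source = Construction Γ s
    module Target = Construction Γ t

  to-ray : ∀ n → ∃ λ m → to (gadget (ray n)) ≡ gadget (ray m)
  to-ray n = Target.RayLike⇒ray (RayLike-to f (Source.RayLike-ray n))

  index : ℕ → ℕ
  index n = proj₁ (to-ray n)

  index-consecutive : ∀ {m n} → Consecutive m n → Consecutive (index m) (index n)
  index-consecutive {m} {n} c = Target.nonNeighbour⇒consecutive
    (subst₂ (NonNeighbour (graph Γ t)) (proj₂ (to-ray m)) (proj₂ (to-ray n))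
      (NonNeighbour-to f (Source.consecutive⇒nonNeighbour c)))

module Rigidity (Γ : CountableGraph) {s t : ℕ → Bool} (f : GraphIso (graph Γ s) (graph Γ t)) where
  open GraphIso f using (to; from; to-from; from-to)
  open ≡-Reasoning
  private
    module Source = Construction Γ s
    module Target = Construction Γ t
    module F = RayIndex Γ f
    module F⁻¹ = RayIndex Γ (GraphIso-sym f)

    index-inverseˡ : ∀ n → F⁻¹.index (F.index n) ≡ n
    index-inverseˡ n = Source.ray-injective (begin
      gadget (ray (F⁻¹.index (F.index n))) ≡⟨ ≡-sym (proj₂ (F⁻¹.to-ray (F.index n))) ⟩
      from (gadget (ray (F.index n)))      ≡⟨ cong from (≡-sym (proj₂ (F.to-ray n))) ⟩
      from (to (gadget (ray n)))           ≡⟨ from-to _ ⟩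
      gadget (ray n)                       ∎)

    index-inverseʳ : ∀ n → F.index (F⁻¹.index n) ≡ n
    index-inverseʳ n = Target.ray-injective (begin
      gadget (ray (F.index (F⁻¹.index n))) ≡⟨ ≡-sym (proj₂ (F.to-ray (F⁻¹.index n))) ⟩
      to (gadget (ray (F⁻¹.index n)))      ≡⟨ cong to (≡-sym (proj₂ (F⁻¹.to-ray n))) ⟩
      to (from (gadget (ray n)))           ≡⟨ to-from _ ⟩
      gadget (ray n)                       ∎)

  to-ray : ∀ n → to (gadget (ray n)) ≡ gadget (ray n)
  to-ray n = trans (proj₂ (F.to-ray n)) (cong (λ z → gadget (ray z))
    (path-automorphism≗id F.index F⁻¹.index index-inverseˡ index-inverseʳ
      F.index-consecutive F⁻¹.index-consecutive n))

  private
    nonNeighbour-of-ray : ∀ {n x} → NonNeighbour (graph Γ s) (gadget (ray n)) x →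
                          NonNeighbour (graph Γ t) (gadget (ray n)) (to x)
    nonNeighbour-of-ray {n} {x} nn =
      subst (λ z → NonNeighbour (graph Γ t) z (to x)) (to-ray n) (NonNeighbour-to f nn)

  to-clique : ∀ i → to (gadget (clique i)) ≡ gadget (clique i)
  to-clique i = Target.clique-at-ray (HasNonNeighbours-to f (Source.clique-has5 i))
    (nonNeighbour-of-ray ((λ ()) , λ adj → adj refl))

  to-pendant : ∀ n p → Σ (T (t n)) λ q → to (gadget (pendant n p)) ≡ gadget (pendant n q)
  to-pendant n p = Target.pendant-at-ray (Source.pendant-few ∘ HasNonNeighbours-from f)
    (nonNeighbour-of-ray ((λ ()) , λ adj → adj refl))

  to-core : ∀ u → ∃ λ w → to (core u) ≡ core w
  to-core u = Target.core-by-rays (HasNonNeighbours-to f (Source.core-has5 u))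
    λ n → subst (λ z → Target.Adj z (to (core u))) (to-ray n) (GraphIso.pres f tt)

T-injective : ∀ {a b} → (T a → T b) → (T b → T a) → a ≡ b
T-injective {false} {false} _ _ = refl
T-injective {false} {true}  _ b⇒a = ⊥-elim (b⇒a tt)
T-injective {true}  {false} a⇒b _ = ⊥-elim (a⇒b tt)
T-injective {true}  {true}  _ _ = refl

graph-determines-sequence : ∀ Γ {s t} → GraphIso (graph Γ s) (graph Γ t) → ∀ n → s n ≡ t n
graph-determines-sequence Γ f n = T-injective
  (λ p → proj₁ (Rigidity.to-pendant Γ f n p))
  (λ q → proj₁ (Rigidity.to-pendant Γ (GraphIso-sym f) n q))

-- Automorphisms

map₁-inverse : ∀ {A B : Set} (g h : A → A) → (∀ a → g (h a) ≡ a) →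
               ∀ (x : A ⊎ B) → map₁ g (map₁ h x) ≡ x
map₁-inverse g h gh (inj₁ a) = cong inj₁ (gh a)
map₁-inverse g h gh (inj₂ _) = refl

module Automorphisms (Γ : CountableGraph) (s : ℕ → Bool) where
  open Construction Γ s hiding (graph)
  open ≡-Reasoning

  module _ (f : Aut (graph Γ s)) where
    open GraphIso f using (to)
    open Rigidity Γ f

    -- Opaque, since unfolding the witness would evaluate the whole rigidity argument.
    opaque
      restrict-to : V Γ → V Γ
      restrict-to u = proj₁ (to-core u)

      restrict-to-core : ∀ u → to (core u) ≡ core (restrict-to u)
      restrict-to-core u = proj₂ (to-core u)

    fixes-gadget : ∀ x → to (gadget x) ≡ gadget x
    fixes-gadget (clique i) = to-clique i
    fixes-gadget (ray n) = to-ray n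
    fixes-gadget (pendant n p) =
      trans (proj₂ (to-pendant n p)) (cong (λ q → gadget (pendant n q)) (T-irrelevant _ p))

  restrict : Aut (graph Γ s) → Aut Γ
  restrict f = record
    { to = restrict-to f
    ; from = restrict-to f⁻¹
    ; to-from = λ u → core-injective (begin
        core (restrict-to f (restrict-to f⁻¹ u)) ≡⟨ ≡-sym (restrict-to-core f (restrict-to f⁻¹ u)) ⟩
        to (core (restrict-to f⁻¹ u))            ≡⟨ cong to (≡-sym (restrict-to-core f⁻¹ u)) ⟩
        to (from (core u))                       ≡⟨ to-from (core u) ⟩
        core u                                   ∎)
    ; from-to = λ u → core-injective (begin
        core (restrict-to f⁻¹ (restrict-to f u)) ≡⟨ ≡-sym (restrict-to-core f⁻¹ (restrict-to f u)) ⟩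
        from (core (restrict-to f u))            ≡⟨ cong from (≡-sym (restrict-to-core f u)) ⟩
        from (to (core u))                       ≡⟨ from-to (core u) ⟩
        core u                                   ∎)
    ; pres = λ {u} {v} e → subst₂ Adj (restrict-to-core f u) (restrict-to-core f v) (pres e)
    ; refl = λ {u} {v} e →
        GraphIso.refl f (subst₂ Adj (≡-sym (restrict-to-core f u)) (≡-sym (restrict-to-core f v)) e)
    }
    where
    open GraphIso f using (to; from; to-from; from-to; pres)
    f⁻¹ = GraphIso-sym f

  extend : Aut Γ → Aut (graph Γ s)
  extend h = record
    { to = map₁ to ; from = map₁ from
    ; to-from = map₁-inverse to from to-from
    ; from-to = map₁-inverse from to from-to
    ; pres = λ {x} {y} → Adj-map₁ to pres {x} {y}
    ; refl = λ {x} {y} adj →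
        subst₂ Adj (map₁-inverse from to from-to x) (map₁-inverse from to from-to y)
          (Adj-map₁ from (GraphIso.pres (GraphIso-sym h)) {map₁ to x} {map₁ to y} adj)
    }
    where open GraphIso h using (to; from; to-from; from-to; pres)

  restrict-extend : ∀ h → restrict (extend h) ≈A h
  restrict-extend h u = core-injective (≡-sym (restrict-to-core (extend h) u))

  restrict-injective : ∀ {f g} → restrict f ≈A restrict g → f ≈A g
  restrict-injective {f} {g} fg (core u) = begin
    GraphIso.to f (core u)        ≡⟨ restrict-to-core f u ⟩
    core (restrict-to f u)        ≡⟨ cong core (fg u) ⟩
    core (restrict-to g u)        ≡⟨ ≡-sym (restrict-to-core g u) ⟩
    GraphIso.to g (core u)        ∎
  restrict-injective {f} {g} _ (gadget x) = trans (fixes-gadget f x) (≡-sym (fixes-gadget g x))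

  restrict-cong : ∀ {f g} → f ≈A g → restrict f ≈A restrict g
  restrict-cong {f} {g} fg u = core-injective (begin
    core (restrict-to f u) ≡⟨ ≡-sym (restrict-to-core f u) ⟩
    GraphIso.to f (core u) ≡⟨ fg (core u) ⟩
    GraphIso.to g (core u) ≡⟨ restrict-to-core g u ⟩
    core (restrict-to g u) ∎)

  restrict-hom : ∀ f g → restrict (f ∘A g) ≈A (restrict f ∘A restrict g)
  restrict-hom f g u = core-injective (begin
    core (restrict-to (f ∘A g) u)          ≡⟨ ≡-sym (restrict-to-core (f ∘A g) u) ⟩
    GraphIso.to f (GraphIso.to g (core u)) ≡⟨ cong (GraphIso.to f) (restrict-to-core g u) ⟩
    GraphIso.to f (core (restrict-to g u)) ≡⟨ restrict-to-core f (restrict-to g u) ⟩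
    core (restrict-to f (restrict-to g u)) ∎)

  Aut-restrict-iso : AutGroupIso (graph Γ s) Γ
  Aut-restrict-iso = record
    { φ = restrict
    ; φ-cong = restrict-cong
    ; φ-hom = restrict-hom
    ; φ-inj = restrict-injective
    ; φ-surj = λ h → extend h , restrict-extend h
    }

theorem3p4 : (Γ : CountableGraph) →
    Σ ((ℕ → Bool) → CountableGraph) (λ F →
    (∀ s → AlgClosed (F s) × AutGroupIso (F s) Γ) ×
    (∀ s t → ¬ (∀ n → s n ≡ t n) → ¬ GraphIso (F s) (F t)))
theorem3p4 Γ =
  graph Γ ,
  (λ s → algebraicallyClosed Γ s , Automorphisms.Aut-restrict-iso Γ s) ,
  λ s t s≢t f → s≢t (graph-determines-sequence Γ f)
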